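{- Let $B$ be a finite set of Boolean functions with $B\subseteq\mathsf{M}$. Then for every $n$-ary function $f\in[B]$, the solution graph $G(f)$ is connected, and for any two solutions $\boldsymbol a,\boldsymbol b$ of $f$ the shortest-path distance in $G(f)$ satisfies $d_f(\boldsymbol a,\boldsymbol b)=|\boldsymbol a-\boldsymbol b|\le n$.
   Context: For an $n$-ary Boolean function $f$, its solution graph $G(f)$ has vertex set $f^{ -1}(1)\subseteq\{0,1\}^n$ (the solutions), two vertices adjacent iff they differ in exactly one coordinate; an empty graph counts as connected. $d_f(\boldsymbol a,\boldsymbol b)$ is the shortest-path distance in $G(f)$, and $|\boldsymbol a-\boldsymbol b|$ is the Hamming distance. $[B]$ denotes the set of Boolean functions obtainable from $B$ and all projections by composition, permutation and identification of variables, and introduction of fictive variables. $\mathsf{M}$ is the set of monotone Boolean functions ($a_i\le b_i$ for all $i$ implies $f(\boldsymbol a)\le f(\boldsymbol b)$). -}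

module Defs where

open import Data.Nat using (ℕ; zero; suc; _+_; _≤_)
open import Data.Bool as Bool using (Bool; true; false; if_then_else_)
open import Data.Fin using (Fin)
open import Data.Vec using (Vec; []; _∷_; lookup; tabulate)
open import Data.Vec.Relation.Binary.Pointwise.Inductive using (Pointwise)
open import Data.List using (List)
open import Data.List.Membership.Propositional using (_∈_)
open import Data.List.Relation.Unary.All using (All)
open import Data.Product using (Σ; ∃; _×_; _,_)
open import Relation.Binary.PropositionalEquality using (_≡_)

BF : ℕ → Set
BF n = Vec Bool n → Bool

AnyBF : Set
AnyBF = Σ ℕ BF

Monotone : AnyBF → Set
Monotone (n , f) = ∀ (a b : Vec Bool n) → Pointwise Bool._≤_ a b → f a Bool.≤ f b

-- [B]: the clone generated by B together with all projections, i.e. closure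
-- under superposition (composition; this subsumes permutation and
-- identification of variables and introduction of fictive variables,
-- since projections of all arities are present).  Functions are identified
-- extensionally (rule `ext`).
data [_] (B : List AnyBF) : ∀ {n} → BF n → Set where
  proj : ∀ {n} (i : Fin n) → [ B ] (λ x → lookup x i)
  base : ∀ {n} {f : BF n} → (n , f) ∈ B → [ B ] f
  comp : ∀ {m n} {g : BF m} {hs : Fin m → BF n} →
         [ B ] g → (∀ i → [ B ] (hs i)) →
         [ B ] (λ x → g (tabulate (λ i → hs i x)))
  ext  : ∀ {n} {f g : BF n} → (∀ x → f x ≡ g x) → [ B ] f → [ B ] g

ham : ∀ {n} → Vec Bool n → Vec Bool n → ℕ
ham [] [] = 0
ham (x ∷ xs) (y ∷ ys) = (if x Bool.xor y then 1 else 0) + ham xs ys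

Sol : ∀ {n} → BF n → Vec Bool n → Set
Sol f a = f a ≡ true

Adj : ∀ {n} → Vec Bool n → Vec Bool n → Set
Adj a b = ham a b ≡ 1

-- Walk f a b k : a walk of length k from a to b in the solution graph G(f)
-- (all vertices are solutions, consecutive vertices adjacent).
data Walk {n} (f : BF n) : Vec Bool n → Vec Bool n → ℕ → Set where
  here : ∀ {a} → Sol f a → Walk f a a 0
  step : ∀ {a c b k} → Sol f a → Adj a c → Walk f c b k → Walk f a b (suc k)

-- G(f) is connected (vacuously true if f has no solutions).
Connected : ∀ {n} → BF n → Set
Connected {n} f = ∀ (a b : Vec Bool n) → Sol f a → Sol f b → ∃ λ k → Walk f a b k

Dist : ∀ {n} → BF n → Vec Bool n → Vec Bool n → ℕ → Set
Dist f a b d = Walk f a b d × (∀ k → Walk f a b k → d ≤ k)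

-- The clone generated by monotone functions consists of monotone functions,
-- so the solutions of f form an up-set of the cube. From a solution a one
-- climbs to a ∨ b by switching on one missing coordinate at a time, every
-- vertex on the way being a solution; the same climb from b, reversed,
-- descends from a ∨ b to b. Since a ∨ b lies between a and b coordinatewise,
-- the two climbs together have length |a − b|, and no walk is shorter because
-- each edge changes the Hamming distance to b by at most one.
module Submission where

open import Defs
open import Data.Nat using (ℕ; zero; suc; pred; _+_; _≤_; z≤n; s≤s)
open import Data.Nat.Properties using (≤-reflexive; ≤-trans; +-mono-≤; +-commutativeSemigroup; module ≤-Reasoning)
open import Data.Bool using (Bool; true; false; _∨_; _xor_; if_then_else_; b≤b; f≤t)
import Data.Bool as Bool
open import Data.Bool.Properties using (xor-comm; ≤-antisym; ≤-minimum; ≤-maximum)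
open import Data.Vec using (Vec; []; _∷_; zipWith)
open import Data.Vec.Relation.Binary.Pointwise.Inductive as Pointwise using (Pointwise; []; _∷_; tabulate⁺)
open import Data.List using (List)
open import Data.List.Relation.Unary.All as All using (All)
open import Data.Product using (∃; _×_; _,_)
open import Algebra.Properties.CommutativeSemigroup +-commutativeSemigroup using (interchange)
open import Relation.Binary.PropositionalEquality using (_≡_; refl; sym; trans; cong; cong₂; subst; subst₂)

private
  variable
    n : ℕ

infix 4 _⊑_
_⊑_ : Vec Bool n → Vec Bool n → Set
_⊑_ = Pointwise Bool._≤_

clone-monotone : ∀ {B f} → All Monotone B → [ B ] f → Monotone (n , f)
clone-monotone mB (proj i) a b a⊑b = Pointwise.lookup a⊑b i
clone-monotone mB (base f∈B) = All.lookup mB f∈B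
clone-monotone mB (comp g hs) a b a⊑b =
  clone-monotone mB g _ _ (tabulate⁺ λ i → clone-monotone mB (hs i) a b a⊑b)
clone-monotone mB (ext f≗g f) a b a⊑b =
  subst₂ Bool._≤_ (f≗g a) (f≗g b) (clone-monotone mB f a b a⊑b)

Sol-upward : ∀ {f : BF n} {a b} → Monotone (n , f) → a ⊑ b → Sol f a → Sol f b
Sol-upward {f = f} {a} {b} mf a⊑b fa = ≤-antisym (≤-maximum (f b)) (subst (Bool._≤ f b) fa (mf a b a⊑b))

δ : Bool → Bool → ℕ
δ x y = if x xor y then 1 else 0

δ≤1 : ∀ x y → δ x y ≤ 1
δ≤1 true  true  = z≤n
δ≤1 true  false = s≤s z≤n
δ≤1 false true  = s≤s z≤n
δ≤1 false false = z≤n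

δ-triangle : ∀ x y z → δ x z ≤ δ x y + δ y z
δ-triangle true  _     true  = z≤n
δ-triangle false _     false = z≤n
δ-triangle true  true  false = s≤s z≤n
δ-triangle true  false false = s≤s z≤n
δ-triangle false true  true  = s≤s z≤n
δ-triangle false false true  = s≤s z≤n

δ-split-∨ : ∀ x y → δ x y ≡ δ x (x ∨ y) + δ (x ∨ y) y
δ-split-∨ true  true  = refl
δ-split-∨ true  false = refl
δ-split-∨ false true  = refl
δ-split-∨ false false = refl

ham-sym : (a b : Vec Bool n) → ham a b ≡ ham b a
ham-sym []       []       = refl
ham-sym (x ∷ a) (y ∷ b) = cong₂ _+_ (cong (if_then 1 else 0) (xor-comm x y)) (ham-sym a b)

ham-self : (a : Vec Bool n) → ham a a ≡ 0
ham-self []        = refl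
ham-self (true ∷ a)  = ham-self a
ham-self (false ∷ a) = ham-self a

ham≡0⇒≡ : {a b : Vec Bool n} → ham a b ≡ 0 → a ≡ b
ham≡0⇒≡ {a = []}        {[]}        _ = refl
ham≡0⇒≡ {a = true ∷ a}  {true ∷ b}  e = cong (true ∷_) (ham≡0⇒≡ e)
ham≡0⇒≡ {a = false ∷ a} {false ∷ b} e = cong (false ∷_) (ham≡0⇒≡ e)

ham≤n : (a b : Vec Bool n) → ham a b ≤ n
ham≤n []       []       = z≤n
ham≤n (x ∷ a) (y ∷ b) = +-mono-≤ (δ≤1 x y) (ham≤n a b)

ham-triangle : (a c b : Vec Bool n) → ham a b ≤ ham a c + ham c b
ham-triangle []       []       []       = z≤n
ham-triangle (x ∷ a) (y ∷ c) (z ∷ b) =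
  ≤-trans (+-mono-≤ (δ-triangle x y z) (ham-triangle a c b))
          (≤-reflexive (interchange (δ x y) (δ y z) (ham a c) (ham c b)))

infixr 6 _∨ᵛ_
_∨ᵛ_ : Vec Bool n → Vec Bool n → Vec Bool n
_∨ᵛ_ = zipWith _∨_

ham-split-∨ᵛ : (a b : Vec Bool n) → ham a b ≡ ham a (a ∨ᵛ b) + ham (a ∨ᵛ b) b
ham-split-∨ᵛ []       []       = refl
ham-split-∨ᵛ (x ∷ a) (y ∷ b) =
  trans (cong₂ _+_ (δ-split-∨ x y) (ham-split-∨ᵛ a b))
        (interchange (δ x (x ∨ y)) (δ (x ∨ y) y) (ham a (a ∨ᵛ b)) (ham (a ∨ᵛ b) b))

⊑-∨ᵛˡ : (a b : Vec Bool n) → a ⊑ a ∨ᵛ b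
⊑-∨ᵛˡ []            []       = []
⊑-∨ᵛˡ (true ∷ a)  (y ∷ b) = b≤b ∷ ⊑-∨ᵛˡ a b
⊑-∨ᵛˡ (false ∷ a) (y ∷ b) = ≤-minimum y ∷ ⊑-∨ᵛˡ a b

⊑-∨ᵛʳ : (a b : Vec Bool n) → b ⊑ a ∨ᵛ b
⊑-∨ᵛʳ []            []       = []
⊑-∨ᵛʳ (true ∷ a)  (y ∷ b) = ≤-maximum y ∷ ⊑-∨ᵛʳ a b
⊑-∨ᵛʳ (false ∷ a) (y ∷ b) = b≤b ∷ ⊑-∨ᵛʳ a b

-- Switching on the first coordinate where a and c differ.
⊑-cover : ∀ {a c : Vec Bool n} {k} → a ⊑ c → ham a c ≡ suc k →
          ∃ λ a′ → Adj a a′ × a ⊑ a′ × a′ ⊑ c × ham a′ c ≡ k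
⊑-cover {a = true ∷ a}  (b≤b ∷ a⊑c) e with ⊑-cover a⊑c e
... | a′ , adj , a⊑a′ , a′⊑c , e′ = true ∷ a′ , adj , b≤b ∷ a⊑a′ , b≤b ∷ a′⊑c , e′
⊑-cover {a = false ∷ a} (b≤b ∷ a⊑c) e with ⊑-cover a⊑c e
... | a′ , adj , a⊑a′ , a′⊑c , e′ = false ∷ a′ , adj , b≤b ∷ a⊑a′ , b≤b ∷ a′⊑c , e′
⊑-cover {a = false ∷ a} (f≤t ∷ a⊑c) e =
  true ∷ a , cong suc (ham-self a) , f≤t ∷ Pointwise.refl b≤b , b≤b ∷ a⊑c , cong pred e

Adj-sym : {a b : Vec Bool n} → Adj a b → Adj b a
Adj-sym {a = a} {b} adj = trans (ham-sym b a) adj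

module _ {f : BF n} where

  walk-snoc : ∀ {a b c k} → Walk f a b k → Adj b c → Sol f c → Walk f a c (suc k)
  walk-snoc (here fa)       adj fc = step fa adj (here fc)
  walk-snoc (step fa adj w) adj′ fc = step fa adj (walk-snoc w adj′ fc)

  walk-reverse : ∀ {a b k} → Walk f a b k → Walk f b a k
  walk-reverse (here fa)                = here fa
  walk-reverse (step {a} {c} fa adj w) = walk-snoc (walk-reverse w) (Adj-sym {a = a} {c} adj) fa

  walk-++ : ∀ {a b c k l} → Walk f a b k → Walk f b c l → Walk f a c (k + l)
  walk-++ (here _)        w′ = w′
  walk-++ (step fa adj w) w′ = step fa adj (walk-++ w w′)

  ham≤walk-length : ∀ {a b k} → Walk f a b k → ham a b ≤ k
  ham≤walk-length {a} (here _) = ≤-reflexive (ham-self a)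
  ham≤walk-length {a} {b} {suc k} (step {c = c} _ adj w) = begin
    ham a b           ≤⟨ ham-triangle a c b ⟩
    ham a c + ham c b ≡⟨ cong (_+ ham c b) adj ⟩
    suc (ham c b)     ≤⟨ s≤s (ham≤walk-length w) ⟩
    suc k             ∎
    where open ≤-Reasoning

  module _ (mf : Monotone (n , f)) where

    ascend : ∀ {a c} → a ⊑ c → Sol f a → Walk f a c (ham a c)
    ascend a⊑c fa = go _ a⊑c refl fa
      where
      go : ∀ k {a c} → a ⊑ c → ham a c ≡ k → Sol f a → Walk f a c k
      go zero {a} {c} a⊑c e fa with refl ← ham≡0⇒≡ {a = a} {c} e = here fa
      go (suc k) a⊑c e fa with ⊑-cover a⊑c e
      ... | a′ , adj , a⊑a′ , a′⊑c , e′ = step fa adj (go k a′⊑c e′ (Sol-upward mf a⊑a′ fa))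

    geodesic : ∀ {a b} → Sol f a → Sol f b → Walk f a b (ham a b)
    geodesic {a} {b} fa fb = subst (Walk f a b) (sym (ham-split-∨ᵛ a b))
      (walk-++ (ascend (⊑-∨ᵛˡ a b) fa)
               (subst (Walk f (a ∨ᵛ b) b) (ham-sym b (a ∨ᵛ b))
                      (walk-reverse (ascend (⊑-∨ᵛʳ a b) fb))))

lemma4p3 : (B : List AnyBF) → All Monotone B →
    ∀ (n : ℕ) (f : BF n) → [ B ] f →
      Connected f ×
      (∀ (a b : Vec Bool n) → Sol f a → Sol f b →
         Dist f a b (ham a b) × ham a b ≤ n)
lemma4p3 B mB n f f∈[B] =
  (λ a b fa fb → ham a b , geodesic mf fa fb) ,
  (λ a b fa fb → (geodesic mf fa fb , λ _ → ham≤walk-length) , ham≤n a b)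
  where
  mf : Monotone (n , f)
  mf = clone-monotone mB f∈[B]
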